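{- Let $m,n$ be coprime positive integers. Then the directed graph $\mathscr{E}_{mn}$ is isomorphic to the tensor product $\mathscr{E}_m\otimes\mathscr{E}_n$.
   Context: For a positive integer $n$, $\mathscr{E}_n$ is the directed graph whose vertices are the pairs $(a,b)$ with $a,b\in\{0,1,\dots,n-1\}$ and $\gcd(a,b,n)=1$, written $a/b$, with a directed edge from $a/b$ to $c/d$ if and only if $ad-bc\equiv1\pmod n$. For directed graphs $G,H$, the tensor product $G\otimes H$ is the directed graph with vertex set $V_G\times V_H$ and a directed edge from $(u_1,v_1)$ to $(u_2,v_2)$ if and only if $u_1\to u_2$ is an edge of $G$ and $v_1\to v_2$ is an edge of $H$. -}

module Defs where

open import Data.Empty using (⊥)
open import Data.Nat using (ℕ; suc; _+_; _*_; _%_; NonZero)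
open import Data.Nat.GCD using (gcd)
open import Data.Fin using (Fin; toℕ)
open import Data.Product using (Σ; _×_; _,_; proj₁; proj₂)
open import Relation.Binary.PropositionalEquality using (_≡_)
open import Function.Bundles using (_↔_; _⇔_; Inverse)

record Digraph : Set₁ where
  field
    V : Set
    E : V → V → Set
open Digraph public

EVert : ℕ → Set
EVert n = Σ (Fin n × Fin n) λ p → gcd (gcd (toℕ (proj₁ p)) (toℕ (proj₂ p))) n ≡ 1

-- Edge a/b → c/d iff a*d - b*c ≡ 1 (mod n), i.e. a*d ≡ b*c + 1 (mod n).
EEdge : (n : ℕ) → EVert n → EVert n → Set
-- (n = 0 has no vertices, so the 0 clause is vacuous.)
EEdge 0 _ _ = ⊥
EEdge n@(suc _) ((a , b) , _) ((c , d) , _) =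
  (toℕ a * toℕ d) % n ≡ (toℕ b * toℕ c + 1) % n

𝓔 : ℕ → Digraph
𝓔 n = record { V = EVert n ; E = EEdge n }

_⊗_ : Digraph → Digraph → Digraph
G ⊗ H = record
  { V = V G × V H
  ; E = λ x y → E G (proj₁ x) (proj₁ y) × E H (proj₂ x) (proj₂ y)
  }

record _≅_ (G H : Digraph) : Set where
  field
    bij : V G ↔ V H
    edges : ∀ u v → E G u v ⇔ E H (Inverse.to bij u) (Inverse.to bij v)

-- By the Chinese remainder theorem, reduction modulo m and modulo n is a bijection
-- ℤ/mn → ℤ/m × ℤ/n respecting + and ·. Applied to both coordinates of a/b it maps
-- vertices to pairs of vertices, since gcd(a, b, mn) = 1 iff gcd(a, b, m) = 1 and
-- gcd(a, b, n) = 1, and edges to pairs of edges, since ad − bc ≡ 1 holds modulo mn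
-- iff it holds modulo m and modulo n.

{-# OPTIONS --safe #-}
module Submission where

open import Defs
open import Data.Nat using (ℕ; _*_; NonZero)
open import Data.Nat.Coprimality using (Coprime)

open import Data.Nat using (suc; _+_; _∸_; _%_; _/_; _≤_)
open import Data.Nat.Properties
open import Data.Nat.DivMod using (_mod_; m≡m%n+[m/n]*n; m%n%n≡m%n; m%n<n; m<n⇒m%n≡m;
  %-distribˡ-+; %-distribˡ-*; %-remove-+ʳ; [m+kn]%n≡m%n; m∣n⇒o%n%m≡o%m)
open import Data.Nat.Divisibility
open import Data.Nat.GCD using (gcd; gcd-greatest; gcd[m,n]∣m; gcd[m,n]∣n; module Bézout)
open import Data.Nat.LCM using (lcm; lcm-least; gcd*lcm)
import Data.Nat.Coprimality as Coprimality
open import Data.Nat.Solver using (module +-*-Solver)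
open import Data.Fin using (Fin; toℕ)
open import Data.Fin.Properties using (toℕ-injective; toℕ-fromℕ<; toℕ<n)
open import Data.Sum using (inj₁; inj₂)
open import Data.Product using (Σ; _×_; _,_; proj₁; proj₂)
open import Level using (0ℓ)
open import Relation.Binary.Bundles using (Setoid)
open import Relation.Binary.PropositionalEquality
open import Function.Bundles using (_⇔_; Equivalence; mk↔ₛ′; mk⇔)

infix 4 _≡[_]_

-- A record rather than a plain equation x % k ≡ y % k, so that x and y can be
-- inferred from the type.
record _≡[_]_ (x k y : ℕ) .{{_ : NonZero k}} : Set where
  constructor ≡-mod
  field %≡% : x % k ≡ y % k
open _≡[_]_

module _ {k : ℕ} .{{_ : NonZero k}} where

  ≡-mod-refl : ∀ {x} → x ≡[ k ] x
  ≡-mod-refl = ≡-mod refl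

  ≡-mod-sym : ∀ {x y} → x ≡[ k ] y → y ≡[ k ] x
  ≡-mod-sym (≡-mod p) = ≡-mod (sym p)

  ≡-mod-trans : ∀ {x y z} → x ≡[ k ] y → y ≡[ k ] z → x ≡[ k ] z
  ≡-mod-trans (≡-mod p) (≡-mod q) = ≡-mod (trans p q)

  +-cong-mod : ∀ {a b c d} → a ≡[ k ] b → c ≡[ k ] d → a + c ≡[ k ] b + d
  +-cong-mod {a} {b} {c} {d} (≡-mod p) (≡-mod q) = ≡-mod (begin
    (a + c) % k             ≡⟨ %-distribˡ-+ a c k ⟩
    (a % k + c % k) % k     ≡⟨ cong₂ (λ u v → (u + v) % k) p q ⟩
    (b % k + d % k) % k     ≡⟨ %-distribˡ-+ b d k ⟨
    (b + d) % k             ∎)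
    where open ≡-Reasoning

  *-cong-mod : ∀ {a b c d} → a ≡[ k ] b → c ≡[ k ] d → a * c ≡[ k ] b * d
  *-cong-mod {a} {b} {c} {d} (≡-mod p) (≡-mod q) = ≡-mod (begin
    (a * c) % k             ≡⟨ %-distribˡ-* a c k ⟩
    (a % k * (c % k)) % k   ≡⟨ cong₂ (λ u v → (u * v) % k) p q ⟩
    (b % k * (d % k)) % k   ≡⟨ %-distribˡ-* b d k ⟨
    (b * d) % k             ∎)
    where open ≡-Reasoning

  toℕ-mod : ∀ x → toℕ (x mod k) ≡[ k ] x
  toℕ-mod x = ≡-mod (trans (cong (_% k) (toℕ-fromℕ< (m%n<n x k))) (m%n%n≡m%n x k))

  mod-≡-toℕ : ∀ {x} (i : Fin k) → x ≡[ k ] toℕ i → x mod k ≡ i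
  mod-≡-toℕ {x} i (≡-mod p) =
    toℕ-injective (trans (toℕ-fromℕ< (m%n<n x k)) (trans p (m<n⇒m%n≡m (toℕ<n i))))

  ≡-mod⇒∣∸ : ∀ {x y} → x ≡[ k ] y → k ∣ y ∸ x
  ≡-mod⇒∣∸ {x} {y} (≡-mod p) = divides (y / k ∸ x / k) (begin
    y ∸ x
      ≡⟨ cong₂ _∸_ (m≡m%n+[m/n]*n y k) (m≡m%n+[m/n]*n x k) ⟩
    (y % k + y / k * k) ∸ (x % k + x / k * k)
      ≡⟨ cong (λ r → (y % k + y / k * k) ∸ (r + x / k * k)) p ⟩
    (y % k + y / k * k) ∸ (y % k + x / k * k)
      ≡⟨ [m+n]∸[m+o]≡n∸o (y % k) (y / k * k) (x / k * k) ⟩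
    y / k * k ∸ x / k * k
      ≡⟨ *-distribʳ-∸ k (y / k) (x / k) ⟨
    (y / k ∸ x / k) * k
      ∎)
    where open ≡-Reasoning

  ∣∸⇒≡-mod : ∀ {x y} → x ≤ y → k ∣ y ∸ x → x ≡[ k ] y
  ∣∸⇒≡-mod {x} {y} x≤y k∣y∸x = ≡-mod (begin
    x % k             ≡⟨ %-remove-+ʳ x k∣y∸x ⟨
    (x + (y ∸ x)) % k ≡⟨ cong (_% k) (m+[n∸m]≡n x≤y) ⟩
    y % k             ∎)
    where open ≡-Reasoning

  ∣-resp-≡-mod : ∀ {d x y} → d ∣ k → x ≡[ k ] y → d ∣ x → d ∣ y
  ∣-resp-≡-mod d∣k (≡-mod p) d∣x = ∣n∣m%n⇒∣m d∣k (subst (_ ∣_) p (%-presˡ-∣ d∣x d∣k))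

≡-mod-setoid : (k : ℕ) .{{_ : NonZero k}} → Setoid 0ℓ 0ℓ
≡-mod-setoid k = record
  { Carrier = ℕ
  ; _≈_ = λ x y → x ≡[ k ] y
  ; isEquivalence = record { refl = ≡-mod-refl ; sym = ≡-mod-sym ; trans = ≡-mod-trans }
  }

module ≡-mod-Reasoning (k : ℕ) .{{_ : NonZero k}} where
  open import Relation.Binary.Reasoning.Setoid (≡-mod-setoid k) public

module _ {m n : ℕ} where

  coprime⇒lcm≡* : Coprime m n → lcm m n ≡ m * n
  coprime⇒lcm≡* m⊥n = begin
    lcm m n           ≡⟨ *-identityˡ (lcm m n) ⟨
    1 * lcm m n       ≡⟨ cong (_* lcm m n) (Coprimality.coprime⇒gcd≡1 m⊥n) ⟨
    gcd m n * lcm m n ≡⟨ gcd*lcm m n ⟩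
    m * n             ∎
    where open ≡-Reasoning

  coprime⇒*∣ : ∀ {o} → Coprime m n → m ∣ o → n ∣ o → m * n ∣ o
  coprime⇒*∣ m⊥n m∣o n∣o = subst (_∣ _) (coprime⇒lcm≡* m⊥n) (lcm-least m∣o n∣o)

  coprime-∣ʳ : ∀ {g} → n ∣ m → Coprime g m → Coprime g n
  coprime-∣ʳ n∣m g⊥m (d∣g , d∣n) = g⊥m (d∣g , ∣-trans d∣n n∣m)

  coprime-*ʳ : ∀ {g} → Coprime g m → Coprime g n → Coprime g (m * n)
  coprime-*ʳ {g} g⊥m g⊥n {d} (d∣g , d∣mn) = g⊥n (d∣g , Coprimality.coprime-divisor d⊥m d∣mn)
    where
    d⊥m : Coprime d m
    d⊥m (c∣d , c∣m) = g⊥m (∣-trans c∣d d∣g , c∣m)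

≡-mod-∣ : ∀ {m k x y} .{{_ : NonZero m}} .{{_ : NonZero k}} → m ∣ k → x ≡[ k ] y → x ≡[ m ] y
≡-mod-∣ {m} {k} {x} {y} m∣k (≡-mod p) = ≡-mod (begin
  x % m       ≡⟨ m∣n⇒o%n%m≡o%m m k x m∣k ⟨
  x % k % m   ≡⟨ cong (_% m) p ⟩
  y % k % m   ≡⟨ m∣n⇒o%n%m≡o%m m k y m∣k ⟩
  y % m       ∎)
  where open ≡-Reasoning

≡-mod-* : ∀ {m n x y} .{{_ : NonZero m}} .{{_ : NonZero n}} .{{_ : NonZero (m * n)}} →
  Coprime m n → x ≡[ m ] y → x ≡[ n ] y → x ≡[ m * n ] y
≡-mod-* {x = x} {y} m⊥n p q with ≤-total x y
... | inj₁ x≤y = ∣∸⇒≡-mod x≤y (coprime⇒*∣ m⊥n (≡-mod⇒∣∸ p) (≡-mod⇒∣∸ q))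
... | inj₂ y≤x = ≡-mod-sym
  (∣∸⇒≡-mod y≤x (coprime⇒*∣ m⊥n (≡-mod⇒∣∸ (≡-mod-sym p)) (≡-mod⇒∣∸ (≡-mod-sym q))))

crt-idempotent : ∀ {m n} .{{_ : NonZero m}} → Coprime m n → Σ ℕ λ e → e ≡[ m ] 1 × n ∣ e
crt-idempotent {m@(suc m′)} {n} m⊥n with Coprimality.coprime-Bézout m⊥n
... | Bézout.-+ x y 1+xm≡yn = y * n , ≡-mod (begin
  y * n % m        ≡⟨ cong (_% m) 1+xm≡yn ⟨
  (1 + x * m) % m  ≡⟨ [m+kn]%n≡m%n 1 x m ⟩
  1 % m            ∎) , n∣m*n y
  where open ≡-Reasoning
-- In this case y n ≡ −1 (mod m), so (m − 1) y n ≡ 1 (mod m).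
... | Bézout.+- x y 1+yn≡xm = m′ * (y * n) , ≡-mod (begin
  m′ * (y * n) % m                  ≡⟨ [m+kn]%n≡m%n (m′ * (y * n)) x m ⟨
  (m′ * (y * n) + x * m) % m        ≡⟨ cong (λ t → (m′ * (y * n) + t) % m) 1+yn≡xm ⟨
  (m′ * (y * n) + (1 + y * n)) % m  ≡⟨ cong (_% m) (m′k+[1+k]≡1+km (y * n)) ⟩
  (1 + y * n * m) % m               ≡⟨ [m+kn]%n≡m%n 1 (y * n) m ⟩
  1 % m                             ∎) , ∣n⇒∣m*n m′ (n∣m*n y)
  where
  open ≡-Reasoning
  open +-*-Solver
  m′k+[1+k]≡1+km : ∀ k → m′ * k + (1 + k) ≡ 1 + k * m
  m′k+[1+k]≡1+km = solve 2 (λ m′ k → m′ :* k :+ (con 1 :+ k) := con 1 :+ k :* (con 1 :+ m′)) refl m′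

x*e+y*f≡x : ∀ {m e f} .{{_ : NonZero m}} x y → e ≡[ m ] 1 → m ∣ f → x * e + y * f ≡[ m ] x
x*e+y*f≡x {m} {e} {f} x y e≡1 m∣f = begin
  x * e + y * f  ≈⟨ ≡-mod (%-remove-+ʳ (x * e) (∣n⇒∣m*n y m∣f)) ⟩
  x * e          ≈⟨ *-cong-mod (≡-mod-refl {x = x}) e≡1 ⟩
  x * 1          ≡⟨ *-identityʳ x ⟩
  x              ∎
  where open ≡-mod-Reasoning m

coprime-gcd-cong : ∀ {k a b a′ b′} .{{_ : NonZero k}} → a ≡[ k ] a′ → b ≡[ k ] b′ →
  Coprime (gcd a b) k → Coprime (gcd a′ b′) k
coprime-gcd-cong {a′ = a′} {b′} a≡a′ b≡b′ g⊥k (d∣g′ , d∣k) = g⊥k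
  ( gcd-greatest (∣-resp-≡-mod d∣k (≡-mod-sym a≡a′) (∣-trans d∣g′ (gcd[m,n]∣m a′ b′)))
                 (∣-resp-≡-mod d∣k (≡-mod-sym b≡b′) (∣-trans d∣g′ (gcd[m,n]∣n a′ b′)))
  , d∣k)

EVert-≡ : ∀ {k} {u v : EVert k} → proj₁ u ≡ proj₁ v → u ≡ v
EVert-≡ {u = p , g} {.p , h} refl = cong (p ,_) (≡-irrelevant g h)

reduceVertex : ∀ {N} k .{{_ : NonZero k}} → k ∣ N → EVert N → EVert k
reduceVertex k k∣N ((a , b) , g) = (toℕ a mod k , toℕ b mod k) ,
  Coprimality.coprime⇒gcd≡1
    (coprime-gcd-cong (≡-mod-sym (toℕ-mod (toℕ a))) (≡-mod-sym (toℕ-mod (toℕ b)))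
      (coprime-∣ʳ k∣N (Coprimality.gcd≡1⇒coprime g)))

ad≡bc+1-cong : ∀ {k a b c d a′ b′ c′ d′} .{{_ : NonZero k}} →
  a ≡[ k ] a′ → b ≡[ k ] b′ → c ≡[ k ] c′ → d ≡[ k ] d′ →
  a * d ≡[ k ] b * c + 1 → a′ * d′ ≡[ k ] b′ * c′ + 1
ad≡bc+1-cong {k} {a} {b} {c} {d} {a′} {b′} {c′} {d′} a≡a′ b≡b′ c≡c′ d≡d′ ad≡bc+1 = begin
  a′ * d′     ≈⟨ *-cong-mod a≡a′ d≡d′ ⟨
  a * d       ≈⟨ ad≡bc+1 ⟩
  b * c + 1   ≈⟨ +-cong-mod (*-cong-mod b≡b′ c≡c′) ≡-mod-refl ⟩
  b′ * c′ + 1 ∎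
  where open ≡-mod-Reasoning k

Adjacent : (k : ℕ) .{{_ : NonZero k}} {N : ℕ} → EVert N → EVert N → Set
Adjacent k ((a , b) , _) ((c , d) , _) = toℕ a * toℕ d ≡[ k ] toℕ b * toℕ c + 1

EEdge⇔Adjacent : ∀ {k} .{{_ : NonZero k}} (u v : EVert k) → EEdge k u v ⇔ Adjacent k u v
EEdge⇔Adjacent {suc _} _ _ = mk⇔ ≡-mod %≡%

Adjacent-∣ : ∀ {k N} .{{_ : NonZero k}} .{{_ : NonZero N}} → k ∣ N →
  (u v : EVert N) → Adjacent N u v → Adjacent k u v
Adjacent-∣ k∣N ((_ , _) , _) ((_ , _) , _) = ≡-mod-∣ k∣N

Adjacent-* : ∀ {m n N} .{{_ : NonZero m}} .{{_ : NonZero n}} .{{_ : NonZero (m * n)}} →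
  Coprime m n → (u v : EVert N) → Adjacent m u v → Adjacent n u v → Adjacent (m * n) u v
Adjacent-* m⊥n ((_ , _) , _) ((_ , _) , _) = ≡-mod-* m⊥n

module _ {k N : ℕ} .{{_ : NonZero k}} (k∣N : k ∣ N) where

  EEdge-reduceVertex⇒Adjacent : (u v : EVert N) →
    EEdge k (reduceVertex k k∣N u) (reduceVertex k k∣N v) → Adjacent k u v
  EEdge-reduceVertex⇒Adjacent u@((a , b) , _) v@((c , d) , _) e =
    ad≡bc+1-cong (toℕ-mod (toℕ a)) (toℕ-mod (toℕ b)) (toℕ-mod (toℕ c)) (toℕ-mod (toℕ d))
      (Equivalence.to (EEdge⇔Adjacent (reduceVertex k k∣N u) (reduceVertex k k∣N v)) e)

  Adjacent⇒EEdge-reduceVertex : (u v : EVert N) →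
    Adjacent k u v → EEdge k (reduceVertex k k∣N u) (reduceVertex k k∣N v)
  Adjacent⇒EEdge-reduceVertex u@((a , b) , _) v@((c , d) , _) adj =
    Equivalence.from (EEdge⇔Adjacent (reduceVertex k k∣N u) (reduceVertex k k∣N v))
      (ad≡bc+1-cong (≡-mod-sym (toℕ-mod (toℕ a))) (≡-mod-sym (toℕ-mod (toℕ b)))
                    (≡-mod-sym (toℕ-mod (toℕ c))) (≡-mod-sym (toℕ-mod (toℕ d))) adj)

module ChineseRemainder {m n : ℕ} .{{_ : NonZero m}} .{{_ : NonZero n}} (m⊥n : Coprime m n) where

  instance
    m*n≢0-instance : NonZero (m * n)
    m*n≢0-instance = m*n≢0 m n

  m∣N : m ∣ m * n
  m∣N = m∣m*n n

  n∣N : n ∣ m * n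
  n∣N = n∣m*n m

  private
    eₘ : Σ ℕ λ e → e ≡[ m ] 1 × n ∣ e
    eₘ = crt-idempotent m⊥n
    eₙ : Σ ℕ λ e → e ≡[ n ] 1 × m ∣ e
    eₙ = crt-idempotent (Coprimality.sym m⊥n)

  crt : ℕ → ℕ → ℕ
  crt x y = x * proj₁ eₘ + y * proj₁ eₙ

  crt-≡₁ : ∀ x y → crt x y ≡[ m ] x
  crt-≡₁ x y = x*e+y*f≡x x y (proj₁ (proj₂ eₘ)) (proj₂ (proj₂ eₙ))

  crt-≡₂ : ∀ x y → crt x y ≡[ n ] y
  crt-≡₂ x y = subst (λ z → z ≡[ n ] y) (+-comm (y * proj₁ eₙ) (x * proj₁ eₘ))
    (x*e+y*f≡x y x (proj₁ (proj₂ eₙ)) (proj₂ (proj₂ eₘ)))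

  fromResidues : Fin m → Fin n → Fin (m * n)
  fromResidues i j = crt (toℕ i) (toℕ j) mod (m * n)

  fromResidues-≡₁ : ∀ i j → toℕ (fromResidues i j) ≡[ m ] toℕ i
  fromResidues-≡₁ i j = ≡-mod-trans (≡-mod-∣ m∣N (toℕ-mod _)) (crt-≡₁ (toℕ i) (toℕ j))

  fromResidues-≡₂ : ∀ i j → toℕ (fromResidues i j) ≡[ n ] toℕ j
  fromResidues-≡₂ i j = ≡-mod-trans (≡-mod-∣ n∣N (toℕ-mod _)) (crt-≡₂ (toℕ i) (toℕ j))

  fromResidues-mod : ∀ (a : Fin (m * n)) → fromResidues (toℕ a mod m) (toℕ a mod n) ≡ a
  fromResidues-mod a = mod-≡-toℕ a (≡-mod-* m⊥n
    (≡-mod-trans (crt-≡₁ aₘ aₙ) (toℕ-mod (toℕ a)))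
    (≡-mod-trans (crt-≡₂ aₘ aₙ) (toℕ-mod (toℕ a))))
    where
    aₘ aₙ : ℕ
    aₘ = toℕ (toℕ a mod m)
    aₙ = toℕ (toℕ a mod n)

  split : EVert (m * n) → EVert m × EVert n
  split v = reduceVertex m m∣N v , reduceVertex n n∣N v

  join : EVert m × EVert n → EVert (m * n)
  join (((a₁ , b₁) , g₁) , ((a₂ , b₂) , g₂)) = (fromResidues a₁ a₂ , fromResidues b₁ b₂) ,
    Coprimality.coprime⇒gcd≡1 (coprime-*ʳ
      (coprime-gcd-cong (≡-mod-sym (fromResidues-≡₁ a₁ a₂)) (≡-mod-sym (fromResidues-≡₁ b₁ b₂))
        (Coprimality.gcd≡1⇒coprime g₁))
      (coprime-gcd-cong (≡-mod-sym (fromResidues-≡₂ a₁ a₂)) (≡-mod-sym (fromResidues-≡₂ b₁ b₂))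
        (Coprimality.gcd≡1⇒coprime g₂)))

  split-join : ∀ t → split (join t) ≡ t
  split-join (((a₁ , b₁) , _) , ((a₂ , b₂) , _)) = cong₂ _,_
    (EVert-≡ (cong₂ _,_ (mod-≡-toℕ a₁ (fromResidues-≡₁ a₁ a₂))
                        (mod-≡-toℕ b₁ (fromResidues-≡₁ b₁ b₂))))
    (EVert-≡ (cong₂ _,_ (mod-≡-toℕ a₂ (fromResidues-≡₂ a₁ a₂))
                        (mod-≡-toℕ b₂ (fromResidues-≡₂ b₁ b₂))))

  join-split : ∀ v → join (split v) ≡ v
  join-split ((a , b) , _) = EVert-≡ (cong₂ _,_ (fromResidues-mod a) (fromResidues-mod b))

  split-edge : ∀ u v → E (𝓔 (m * n)) u v → E (𝓔 m ⊗ 𝓔 n) (split u) (split v)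
  split-edge u v e =
    Adjacent⇒EEdge-reduceVertex m∣N u v (Adjacent-∣ m∣N u v adj) ,
    Adjacent⇒EEdge-reduceVertex n∣N u v (Adjacent-∣ n∣N u v adj)
    where
    adj : Adjacent (m * n) u v
    adj = Equivalence.to (EEdge⇔Adjacent u v) e

  split-edge⁻¹ : ∀ u v → E (𝓔 m ⊗ 𝓔 n) (split u) (split v) → E (𝓔 (m * n)) u v
  split-edge⁻¹ u v (e₁ , e₂) = Equivalence.from (EEdge⇔Adjacent u v)
    (Adjacent-* m⊥n u v (EEdge-reduceVertex⇒Adjacent m∣N u v e₁)
                        (EEdge-reduceVertex⇒Adjacent n∣N u v e₂))

lemma1 : (m n : ℕ) → .{{NonZero m}} → .{{NonZero n}} → Coprime m n →
    𝓔 (m * n) ≅ (𝓔 m ⊗ 𝓔 n)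
lemma1 m n m⊥n = record
  { bij = mk↔ₛ′ split join split-join join-split
  ; edges = λ u v → mk⇔ (split-edge u v) (split-edge⁻¹ u v)
  }
  where open ChineseRemainder m⊥n
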